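{- There exists a countable $\aleph_0$-categorical semigroup $S$ with zero $0$ which is nil but not nilpotent, i.e. there is $n$ with $a^n=0$ for all $a\in S$, but $S^m\neq\{0\}$ for every $m\in\mathbb{N}$.
   Context: A countable semigroup $S$ is $\aleph_0$-categorical if for every $n\ge1$ the coordinatewise action of $\operatorname{Aut}(S)$ on $S^n$ has only finitely many orbits. A semigroup $S$ with zero $0$ is nil of degree $n$ if $a^n=0$ for all $a\in S$, and nilpotent of degree $n$ if $S^n=\{0\}$ (where $S^n$ is the set of all products of $n$ elements). -}

module Defs where

open import Data.Nat using (ℕ; zero; suc; _≤_)
open import Data.Fin using (Fin; zero; suc)
open import Data.Product using (Σ; ∃; ∃-syntax; _×_; _,_; proj₁)
open import Relation.Binary.PropositionalEquality using (_≡_; _≢_)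
open import Algebra.Structures using (IsSemigroup)
open import Function.Bundles using (_↔_; Inverse)
open import Function.Definitions using (Injective)

record SemigroupWithZero : Set₁ where
  field
    Carrier     : Set
    _∙_         : Carrier → Carrier → Carrier
    isSemigroup : IsSemigroup _≡_ _∙_
    0#          : Carrier
    zeroˡ       : ∀ a → 0# ∙ a ≡ 0#
    zeroʳ       : ∀ a → a ∙ 0# ≡ 0#

module _ (S : SemigroupWithZero) where
  open SemigroupWithZero S

  Countable : Set
  Countable = Σ (Carrier → ℕ) λ f → Injective _≡_ _≡_ f

  Automorphism : Set
  Automorphism = Σ (Carrier ↔ Carrier) λ α →
    ∀ x y → Inverse.to α (x ∙ y) ≡ (Inverse.to α x ∙ Inverse.to α y)

  aut : Automorphism → Carrier → Carrier
  aut α = Inverse.to (proj₁ α)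

  -- The coordinatewise action of Aut(S) on S^n has finitely many orbits:
  -- there are finitely many n-tuples (reps 0, …, reps (k-1)) such that every
  -- n-tuple lies in the Aut(S)-orbit of one of them.
  FinitelyManyOrbits : ℕ → Set
  FinitelyManyOrbits n =
    Σ ℕ λ k → Σ (Fin k → Fin n → Carrier) λ reps →
      (t : Fin n → Carrier) →
        Σ (Fin k) λ i → Σ Automorphism λ α → (∀ j → aut α (reps i j) ≡ t j)

  ℵ₀-categorical : Set
  ℵ₀-categorical = Countable × ((n : ℕ) → 1 ≤ n → FinitelyManyOrbits n)

  -- power a ^ n for n ≥ 1:  a ^ 1 = a,  a ^ (n+1) = a ∙ a ^ n
  -- (a ^ 0 is set to a; it is never used, since n ≥ 1 is required below)
  _^_ : Carrier → ℕ → Carrier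
  a ^ zero = a
  a ^ suc zero = a
  a ^ suc (suc n) = a ∙ (a ^ suc n)

  prod : ∀ {m} → (Fin (suc m) → Carrier) → Carrier
  prod {zero}  x = x zero
  prod {suc m} x = x zero ∙ prod (λ i → x (suc i))

  Nil : Set
  Nil = Σ ℕ λ n → 1 ≤ n × (∀ a → a ^ n ≡ 0#)

  Nilpotent : Set
  Nilpotent = Σ ℕ λ n → ∀ (x : Fin (suc n) → Carrier) → prod x ≡ 0#

-- S consists of 0 and all pairs (a , b) of rationals, multiplied by
-- (a , b) (c , d) = (a , d) if a < b < c < d, and 0 otherwise.
--   * Nil: x x = 0 for every x, since (a , b) (a , b) would need b < a.
--   * Not nilpotent: the blocks (2k , 2k + 1) chain, so (0,1) (2,3) … (2m,2m+1) ≠ 0.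
--   * Countable: pairs of rationals inject into ℕ through 2 ^ m (2 n + 1).
--   * ℵ₀-categorical: every order automorphism of ℚ acts on S as (a , b) ↦ (h a , h b).
--     ℚ is homogeneous: the finitely many endpoints of an n-tuple of elements
--     can be moved onto naturals below 2n. Hence every n-tuple is in the orbit
--     of a tuple of "codes" with endpoints in {0, …, 2n - 1}, and there are
--     finitely many such tuples.

module Submission where

open import Defs
open import Data.Nat using (ℕ; zero; suc; z≤n; s≤s)
import Data.Nat as ℕ
import Data.Nat.Properties as ℕ
import Data.Nat.Coprimality as Coprime
import Data.Integer as ℤ
import Data.Integer.Properties as ℤ
open import Data.Rational
open import Data.Rational.Properties
open import Data.Rational.Solver using (module +-*-Solver)
open import Data.Product using (Σ; _×_; _,_; proj₁; proj₂)
open import Data.Unit using (⊤; tt)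
open import Data.List using (List; []; _∷_; _++_; length; deduplicate)
open import Data.List.Relation.Unary.All as All using (All; []; _∷_)
open import Data.List.Relation.Unary.AllPairs as AllPairs using (AllPairs; []; _∷_)
open import Data.List.Relation.Unary.Any using (here; there)
open import Data.List.Membership.Propositional using (_∈_)
open import Data.List.Membership.Propositional.Properties using (∈-deduplicate⁺; ∈-++⁺ˡ; ∈-++⁺ʳ)
open import Data.List.Relation.Unary.Unique.DecPropositional.Properties _≟_ using (deduplicate-!)
open import Data.List.Relation.Unary.Sorted.TotalOrder.Properties using (Sorted⇒AllPairs)
open import Data.List.Relation.Binary.Permutation.Propositional.Properties using (∈-resp-↭; ↭-length)
open import Data.List.Relation.Binary.Permutation.Propositional using (↭-sym; ↭⇒↭ₛ)
import Data.List.Relation.Binary.Permutation.Setoid.Properties as Permutationₛ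
open import Data.List.Sort ≤-decTotalOrder using (sort; sort-↭; sort-↗)
open import Data.List.Properties using (length-deduplicate; length-++)
open import Data.Empty using (⊥-elim)
open import Relation.Nullary using (Dec; yes; no; ¬_)
open import Relation.Nullary.Decidable using (_×-dec_)
open import Data.Maybe using (Maybe; just; nothing)
open import Data.Fin using (Fin; zero; suc; toℕ; fromℕ<; combine; remQuot; finToFun; funToFin)
open import Data.Fin.Properties using (toℕ-fromℕ<; remQuot-combine; finToFun-funToFin)
open import Function using (_∘_)
open import Function.Bundles using (mk↔ₛ′)
open import Relation.Binary.Definitions using (tri<; tri≈; tri>)
open import Relation.Binary.Bundles using (DecTotalOrder)
open import Relation.Binary.PropositionalEquality
open import Relation.Binary.PropositionalEquality.Properties using (setoid)

open +-*-Solver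

-- The natural numbers inside ℚ; they serve as the standard points onto which
-- the endpoints of a tuple of intervals are moved.
fromℕ : ℕ → ℚ
fromℕ n = mkℚ (ℤ.+ n) 0 (Coprime.sym (Coprime.1-coprimeTo n))

fromℕ-mono-< : ∀ {m n} → m ℕ.< n → fromℕ m < fromℕ n
fromℕ-mono-< {m} {n} m<n =
  *<* (subst₂ ℤ._<_ (sym (ℤ.*-identityʳ (ℤ.+ m))) (sym (ℤ.*-identityʳ (ℤ.+ n))) (ℤ.+<+ m<n))

record OrderAut : Set where
  field
    to from : ℚ → ℚ
    to-from : ∀ x → to (from x) ≡ x
    from-to : ∀ x → from (to x) ≡ x
    to-mono : ∀ {x y} → x < y → to x < to y

  to-reflects : ∀ {x y} → to x < to y → x < y
  to-reflects {x} {y} tx<ty with <-cmp x y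
  ... | tri< x<y _ _ = x<y
  ... | tri≈ _ refl _ = ⊥-elim (<-irrefl refl tx<ty)
  ... | tri> _ _ y<x = ⊥-elim (<-asym tx<ty (to-mono y<x))

open OrderAut public

idᵒ : OrderAut
idᵒ = record { to = λ x → x ; from = λ x → x
  ; to-from = λ _ → refl ; from-to = λ _ → refl ; to-mono = λ x<y → x<y }

infixr 9 _∘ᵒ_
_∘ᵒ_ : OrderAut → OrderAut → OrderAut
s ∘ᵒ h = record
  { to = λ x → to s (to h x) ; from = λ x → from h (from s x)
  ; to-from = λ x → trans (cong (to s) (to-from h (from s x))) (to-from s x)
  ; from-to = λ x → trans (cong (from h) (from-to s (to h x))) (from-to h x)
  ; to-mono = λ x<y → to-mono s (to-mono h x<y) }

translate : ℚ → OrderAut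
translate c = record
  { to = λ x → x + c ; from = λ x → x - c
  ; to-from = λ x → solve 2 (λ x c → (x :- c) :+ c := x) refl x c
  ; from-to = λ x → solve 2 (λ x c → (x :+ c) :- c := x) refl x c
  ; to-mono = +-monoˡ-< c }

-- Arithmetic facts about a - l * (a - x), the map that scales the half-line
-- below a by the factor l about the point a.
module _ (a : ℚ) where

  below-pos : ∀ {x} → x < a → Positive (a - x)
  below-pos {x} x<a = positive (subst (_< a - x) (+-inverseʳ x) (+-monoˡ-< (- x) x<a))

  shrink-below : ∀ p .{{_ : Positive p}} → a - p < a
  shrink-below p = subst (a - p <_) (+-identityʳ a) (+-monoʳ-< a (neg-antimono-< (positive⁻¹ p)))

  scaled-below : ∀ l .{{_ : Positive l}} {x} → x < a → a - l * (a - x) < a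
  scaled-below l {x} x<a = shrink-below (l * (a - x)) {{pos*pos⇒pos l (a - x) {{below-pos x<a}}}}

  scaled-mono : ∀ l .{{_ : Positive l}} {x y} → x < y → a - l * (a - x) < a - l * (a - y)
  scaled-mono l {x} {y} x<y =
    +-monoʳ-< a (neg-antimono-< (*-monoʳ-<-pos l (+-monoʳ-< a (neg-antimono-< x<y))))

  scaled-inverse : ∀ l m x → m * l ≡ 1ℚ → a - m * (a - (a - l * (a - x))) ≡ x
  scaled-inverse l m x ml≡1 = begin
    a - m * (a - (a - l * (a - x)))
      ≡⟨ solve 4 (λ a l m x → a :- m :* (a :- (a :- l :* (a :- x))) := a :- (m :* l) :* (a :- x)) refl a l m x ⟩
    a - (m * l) * (a - x)
      ≡⟨ cong (λ z → a - z * (a - x)) ml≡1 ⟩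
    a - 1ℚ * (a - x)
      ≡⟨ solve 2 (λ a x → a :- con 1ℚ :* (a :- x) := x) refl a x ⟩
    x ∎
    where open ≡-Reasoning

scaleMap : ℚ → ℚ → ℚ → ℚ
scaleMap a l x with x <? a
... | yes _ = a - l * (a - x)
... | no _ = x

scaleMap-below : ∀ a l {x} → x < a → scaleMap a l x ≡ a - l * (a - x)
scaleMap-below a l {x} x<a with x <? a
... | yes _ = refl
... | no x≮a = ⊥-elim (x≮a x<a)

scaleMap-above : ∀ a l {x} → ¬ x < a → scaleMap a l x ≡ x
scaleMap-above a l {x} x≮a with x <? a
... | yes x<a = ⊥-elim (x≮a x<a)
... | no _ = refl

module _ (a l : ℚ) .{{_ : Positive l}} where

  scaleMap-stays-below : ∀ {x} → x < a → scaleMap a l x < a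
  scaleMap-stays-below x<a = subst (_< a) (sym (scaleMap-below a l x<a)) (scaled-below a l x<a)

  scaleMap-mono : ∀ {x y} → x < y → scaleMap a l x < scaleMap a l y
  scaleMap-mono {x} {y} x<y = by-cases (x <? a) (y <? a)
    where
    by-cases : Dec (x < a) → Dec (y < a) → scaleMap a l x < scaleMap a l y
    by-cases (yes x<a) (yes y<a) =
      subst₂ _<_ (sym (scaleMap-below a l x<a)) (sym (scaleMap-below a l y<a)) (scaled-mono a l x<y)
    by-cases (yes x<a) (no y≮a) =
      <-≤-trans (scaleMap-stays-below x<a) (subst (a ≤_) (sym (scaleMap-above a l y≮a)) (≮⇒≥ y≮a))
    by-cases (no x≮a) (yes y<a) = ⊥-elim (x≮a (<-trans x<y y<a))
    by-cases (no x≮a) (no y≮a) =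
      subst₂ _<_ (sym (scaleMap-above a l x≮a)) (sym (scaleMap-above a l y≮a)) x<y

  scaleMap-inverse : ∀ m .{{_ : Positive m}} → m * l ≡ 1ℚ → ∀ x → scaleMap a m (scaleMap a l x) ≡ x
  scaleMap-inverse m ml≡1 x = by-cases (x <? a)
    where
    open ≡-Reasoning
    by-cases : Dec (x < a) → scaleMap a m (scaleMap a l x) ≡ x
    by-cases (yes x<a) = begin
      scaleMap a m (scaleMap a l x)   ≡⟨ cong (scaleMap a m) (scaleMap-below a l x<a) ⟩
      scaleMap a m (a - l * (a - x))  ≡⟨ scaleMap-below a m (scaled-below a l x<a) ⟩
      a - m * (a - (a - l * (a - x))) ≡⟨ scaled-inverse a l m x ml≡1 ⟩
      x                               ∎
    by-cases (no x≮a) = trans (cong (scaleMap a m) (scaleMap-above a l x≮a)) (scaleMap-above a m x≮a)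

scaleBelow : (a l : ℚ) .{{_ : Positive l}} → OrderAut
scaleBelow a l = record
  { to = scaleMap a l ; from = scaleMap a l⁻¹
  ; to-from = scaleMap-inverse a l⁻¹ {{l⁻¹-pos}} l (*-inverseʳ l)
  ; from-to = scaleMap-inverse a l l⁻¹ {{l⁻¹-pos}} (*-inverseˡ l)
  ; to-mono = scaleMap-mono a l }
  where
  instance
    l≢0 : NonZero l
    l≢0 = pos⇒nonZero l
  l⁻¹ = 1/ l
  l⁻¹-pos : Positive l⁻¹
  l⁻¹-pos = 1/pos⇒pos l

pullBelow : ∀ {u v w} → u < w → v < w →
  Σ OrderAut λ s → to s u ≡ v × (∀ x → w ≤ x → to s x ≡ x)
pullBelow {u} {v} {w} u<w v<w = scaleBelow w l , moves-u , fixes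
  where
  instance
    w-u-pos : Positive (w - u)
    w-u-pos = below-pos w u<w
    w-u≢0 : NonZero (w - u)
    w-u≢0 = pos⇒nonZero (w - u)
    w-v-pos : Positive (w - v)
    w-v-pos = below-pos w v<w
  i = 1/ (w - u)
  l = (w - v) * i
  instance
    l-pos : Positive l
    l-pos = pos*pos⇒pos (w - v) i {{1/pos⇒pos (w - u)}}
  open ≡-Reasoning
  moves-u : scaleMap w l u ≡ v
  moves-u = begin
    scaleMap w l u              ≡⟨ scaleMap-below w l u<w ⟩
    w - ((w - v) * i) * (w - u) ≡⟨ cong (λ z → w - z) (*-assoc (w - v) i (w - u)) ⟩
    w - (w - v) * (i * (w - u)) ≡⟨ cong (λ z → w - (w - v) * z) (*-inverseˡ (w - u)) ⟩
    w - (w - v) * 1ℚ            ≡⟨ solve 2 (λ w v → w :- (w :- v) :* con 1ℚ := v) refl w v ⟩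
    v                           ∎
  fixes : ∀ x → w ≤ x → scaleMap w l x ≡ x
  fixes x w≤x = scaleMap-above w l (λ x<w → <-irrefl refl (<-≤-trans x<w w≤x))

≤∧≢⇒< : ∀ {x y} → x ≤ y → x ≢ y → x < y
≤∧≢⇒< {x} {y} x≤y x≢y with <-cmp x y
... | tri< x<y _ _ = x<y
... | tri≈ _ x≡y _ = ⊥-elim (x≢y x≡y)
... | tri> _ _ y<x = ⊥-elim (<-irrefl refl (≤-<-trans x≤y y<x))

strictSort : List ℚ → List ℚ
strictSort L = sort (deduplicate _≟_ L)

strictSort-increasing : ∀ L → AllPairs _<_ (strictSort L)
strictSort-increasing L = AllPairs.zipWith (λ (x≤y , x≢y) → ≤∧≢⇒< x≤y x≢y)
  ( Sorted⇒AllPairs (DecTotalOrder.totalOrder ≤-decTotalOrder) (sort-↗ (deduplicate _≟_ L))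
  , Permutationₛ.Unique-resp-↭ (setoid ℚ) (↭⇒↭ₛ (↭-sym (sort-↭ _))) (deduplicate-! L))

strictSort-⊇ : ∀ L {z} → z ∈ L → z ∈ strictSort L
strictSort-⊇ L z∈L = ∈-resp-↭ (↭-sym (sort-↭ _)) (∈-deduplicate⁺ _≟_ z∈L)

strictSort-length : ∀ L → length (strictSort L) ℕ.≤ length L
strictSort-length L = subst (ℕ._≤ length L) (sym (↭-length (sort-↭ _))) (length-deduplicate _≟_ L)

Enumerates : OrderAut → ℕ → List ℚ → Set
Enumerates h k [] = ⊤
Enumerates h k (v ∷ vs) = to h (fromℕ k) ≡ v × Enumerates h (suc k) vs

enumerates-∘-fixing : ∀ s h k vs → All (λ x → to s x ≡ x) vs → Enumerates h k vs → Enumerates (s ∘ᵒ h) k vs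
enumerates-∘-fixing s h k [] [] tt = tt
enumerates-∘-fixing s h k (v ∷ vs) (sv≡v ∷ fixed) (hk≡v , rest) =
  trans (cong (to s) hk≡v) sv≡v , enumerates-∘-fixing s h (suc k) vs fixed rest

-- The list is built from the right: the tail is enumerated first, then the
-- image of k is pulled to the head without moving anything at or above the tail.
enumerate : ∀ k vs → AllPairs _<_ vs → Σ OrderAut λ h → Enumerates h k vs
enumerate k [] [] = idᵒ , tt
enumerate k (v ∷ []) _ = translate (v - fromℕ k) , lands-on-v , tt
  where
  lands-on-v : fromℕ k + (v - fromℕ k) ≡ v
  lands-on-v = solve 2 (λ n v → n :+ (v :- n) := v) refl (fromℕ k) v
enumerate k (v ∷ w ∷ vs) ((v<w ∷ _) ∷ increasing@(w<vs ∷ _))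
  with enumerate (suc k) (w ∷ vs) increasing
... | h , hk+1≡w , rest = s ∘ᵒ h , su≡v , enumerates-∘-fixing s h (suc k) (w ∷ vs) fixed (hk+1≡w , rest)
  where
  u<w : to h (fromℕ k) < w
  u<w = subst (to h (fromℕ k) <_) hk+1≡w (to-mono h (fromℕ-mono-< (ℕ.n<1+n k)))
  pulled = pullBelow u<w v<w
  s : OrderAut
  s = proj₁ pulled
  su≡v : to s (to h (fromℕ k)) ≡ v
  su≡v = proj₁ (proj₂ pulled)
  fixed : All (λ x → to s x ≡ x) (w ∷ vs)
  fixed = proj₂ (proj₂ pulled) w ≤-refl ∷ All.map (λ w<x → proj₂ (proj₂ pulled) _ (<⇒≤ w<x)) w<vs

enumerated-rank : ∀ h k vs → Enumerates h k vs → ∀ {z} → z ∈ vs →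
  Σ ℕ λ r → r ℕ.< k ℕ.+ length vs × to h (fromℕ r) ≡ z
enumerated-rank h k (v ∷ vs) (hk≡v , _) (here refl) = k , ℕ.m<m+n k (s≤s z≤n) , hk≡v
enumerated-rank h k (v ∷ vs) (_ , rest) (there z∈vs) with enumerated-rank h (suc k) vs rest z∈vs
... | r , r<bound , hr≡z = r , subst (r ℕ.<_) (sym (ℕ.+-suc k (length vs))) r<bound , hr≡z

homogeneous : ∀ L → Σ OrderAut λ h → ∀ {z} → z ∈ L →
  Σ ℕ λ r → r ℕ.< length L × to h (fromℕ r) ≡ z
homogeneous L = h , represented
  where
  enumerated = enumerate 0 (strictSort L) (strictSort-increasing L)
  h = proj₁ enumerated
  represented : ∀ {z} → z ∈ L → Σ ℕ λ r → r ℕ.< length L × to h (fromℕ r) ≡ z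
  represented z∈L with enumerated-rank h 0 (strictSort L) (proj₂ enumerated) (strictSort-⊇ L z∈L)
  ... | r , r<len , hr≡z = r , ℕ.<-≤-trans r<len (strictSort-length L) , hr≡z

-- The semigroup S: elements are 0 (nothing) and pairs (a , b) of rationals, and
-- (a , b) ∙ (c , d) = (a , d) when a < b < c < d, all other products being 0.
Elem : Set
Elem = Maybe (ℚ × ℚ)

Chain : ℚ → ℚ → ℚ → ℚ → Set
Chain a b c d = a < b × b < c × c < d

chain? : ∀ a b c d → Dec (Chain a b c d)
chain? a b c d = a <? b ×-dec b <? c ×-dec c <? d

join : ∀ {P : Set} → Dec P → ℚ → ℚ → Elem
join (yes _) a d = just (a , d)
join (no _) a d = nothing

module _ (a d : ℚ) where

  join-yes : ∀ {P : Set} → P → (p? : Dec P) → join p? a d ≡ just (a , d)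
  join-yes p (yes _) = refl
  join-yes p (no ¬p) = ⊥-elim (¬p p)

  join-no : ∀ {P : Set} → ¬ P → (p? : Dec P) → join p? a d ≡ nothing
  join-no ¬p (yes p) = ⊥-elim (¬p p)
  join-no ¬p (no _) = refl

  join-cong : ∀ {P Q : Set} → (P → Q) → (Q → P) → (p? : Dec P) (q? : Dec Q) → join p? a d ≡ join q? a d
  join-cong P⇒Q Q⇒P (yes p) q? = sym (join-yes (P⇒Q p) q?)
  join-cong P⇒Q Q⇒P (no ¬p) q? = sym (join-no (λ q → ¬p (Q⇒P q)) q?)

infixl 7 _∙_
_∙_ : Elem → Elem → Elem
just (a , b) ∙ just (c , d) = join (chain? a b c d) a d
just _ ∙ nothing = nothing
nothing ∙ _ = nothing

∙-zeroʳ : ∀ x → x ∙ nothing ≡ nothing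
∙-zeroʳ nothing = refl
∙-zeroʳ (just _) = refl

-- Both bracketings of (a , b) (c , d) (e , f) are (a , f) exactly when a < b < c < d < e < f.
∙-assoc : ∀ x y z → (x ∙ y) ∙ z ≡ x ∙ (y ∙ z)
∙-assoc nothing y z = refl
∙-assoc (just x) nothing z = refl
∙-assoc (just (a , b)) (just (c , d)) nothing = ∙-zeroʳ (join (chain? a b c d) a d)
∙-assoc (just (a , b)) (just (c , d)) (just (e , f)) = by-cases (chain? a b c d) (chain? c d e f)
  where
  by-cases : (l? : Dec (Chain a b c d)) (r? : Dec (Chain c d e f)) →
    join l? a d ∙ just (e , f) ≡ just (a , b) ∙ join r? c f
  by-cases (yes (a<b , b<c , c<d)) (yes (_ , d<e , e<f)) = trans
    (join-yes a f (<-trans a<b (<-trans b<c c<d) , d<e , e<f) (chain? a d e f))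
    (sym (join-yes a f (a<b , b<c , <-trans c<d (<-trans d<e e<f)) (chain? a b c f)))
  by-cases (yes (_ , _ , c<d)) (no ¬cdef) =
    join-no a f (λ (_ , d<e , e<f) → ¬cdef (c<d , d<e , e<f)) (chain? a d e f)
  by-cases (no ¬abcd) (yes (c<d , _ , _)) =
    sym (join-no a f (λ (a<b , b<c , _) → ¬abcd (a<b , b<c , c<d)) (chain? a b c f))
  by-cases (no _) (no _) = refl

S : SemigroupWithZero
S = record
  { Carrier = Elem ; _∙_ = _∙_
  ; isSemigroup = record { isMagma = record { isEquivalence = isEquivalence ; ∙-cong = cong₂ _∙_ } ; assoc = ∙-assoc }
  ; 0# = nothing ; zeroˡ = λ _ → refl ; zeroʳ = ∙-zeroʳ }

-- S is nil of degree 2: (a , b) (a , b) would need b < a < b.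
∙-square : ∀ x → x ∙ x ≡ nothing
∙-square nothing = refl
∙-square (just (a , b)) = join-no a b (λ (a<b , b<a , _) → <-asym a<b b<a) (chain? a b a b)

mapElem : (ℚ → ℚ) → Elem → Elem
mapElem f nothing = nothing
mapElem f (just (a , b)) = just (f a , f b)

mapElem-inverse : ∀ {f g} → (∀ x → f (g x) ≡ x) → ∀ e → mapElem f (mapElem g e) ≡ e
mapElem-inverse fg nothing = refl
mapElem-inverse fg (just (a , b)) = cong just (cong₂ _,_ (fg a) (fg b))

mapElem-join : ∀ f {P : Set} (p? : Dec P) a d → mapElem f (join p? a d) ≡ join p? (f a) (f d)
mapElem-join f (yes _) a d = refl
mapElem-join f (no _) a d = refl

-- an order automorphism preserves and reflects the condition a < b < c < d,
-- so the induced map is multiplicative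
mapElem-hom : ∀ h x y → mapElem (to h) (x ∙ y) ≡ mapElem (to h) x ∙ mapElem (to h) y
mapElem-hom h nothing y = refl
mapElem-hom h (just x) nothing = refl
mapElem-hom h (just (a , b)) (just (c , d)) = trans
  (mapElem-join (to h) (chain? a b c d) a d)
  (join-cong (to h a) (to h d)
    (λ (a<b , b<c , c<d) → to-mono h a<b , to-mono h b<c , to-mono h c<d)
    (λ (a<b , b<c , c<d) → to-reflects h a<b , to-reflects h b<c , to-reflects h c<d)
    (chain? a b c d) (chain? (to h a) (to h b) (to h c) (to h d)))

induced : OrderAut → Automorphism S
induced h =
  mk↔ₛ′ (mapElem (to h)) (mapElem (from h)) (mapElem-inverse (to-from h)) (mapElem-inverse (from-to h)) ,
  mapElem-hom h

-- Codes for elements whose endpoints lie in {0, …, M - 1}: zero codes 0 and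
-- suc (combine i j) codes the pair (i , j).
Code : ℕ → Set
Code M = Fin (suc (M ℕ.* M))

decodePair : ∀ {M} → Fin M × Fin M → Elem
decodePair (i , j) = just (fromℕ (toℕ i) , fromℕ (toℕ j))

decode : ∀ M → Code M → Elem
decode M zero = nothing
decode M (suc c) = decodePair (remQuot M c)

endpoints : Elem → List ℚ
endpoints nothing = []
endpoints (just (a , b)) = a ∷ b ∷ []

Represented : OrderAut → ℕ → ℚ → Set
Represented h M z = Σ ℕ λ r → r ℕ.< M × to h (fromℕ r) ≡ z

encode : ∀ h M e → All (Represented h M) (endpoints e) → Code M
encode h M nothing [] = zero
encode h M (just _) ((ra , ra<M , _) ∷ (rb , rb<M , _) ∷ []) = suc (combine (fromℕ< ra<M) (fromℕ< rb<M))

decode-encode : ∀ h M e (reps : All (Represented h M) (endpoints e)) →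
  mapElem (to h) (decode M (encode h M e reps)) ≡ e
decode-encode h M nothing [] = refl
decode-encode h M (just (a , b)) ((ra , ra<M , hra≡a) ∷ (rb , rb<M , hrb≡b) ∷ []) = begin
  mapElem (to h) (decodePair (remQuot M (combine i j)))
    ≡⟨ cong (mapElem (to h) ∘ decodePair) (remQuot-combine i j) ⟩
  just (to h (fromℕ (toℕ i)) , to h (fromℕ (toℕ j)))
    ≡⟨ cong₂ (λ r s → just (to h (fromℕ r) , to h (fromℕ s))) (toℕ-fromℕ< ra<M) (toℕ-fromℕ< rb<M) ⟩
  just (to h (fromℕ ra) , to h (fromℕ rb))
    ≡⟨ cong₂ (λ x y → just (x , y)) hra≡a hrb≡b ⟩
  just (a , b) ∎
  where
  open ≡-Reasoning
  i = fromℕ< ra<M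
  j = fromℕ< rb<M

tupleEndpoints : ∀ n → (Fin n → Elem) → List ℚ
tupleEndpoints zero t = []
tupleEndpoints (suc n) t = endpoints (t zero) ++ tupleEndpoints n (t ∘ suc)

tupleEndpoints-⊇ : ∀ n t j {z} → z ∈ endpoints (t j) → z ∈ tupleEndpoints n t
tupleEndpoints-⊇ (suc n) t zero z∈ = ∈-++⁺ˡ z∈
tupleEndpoints-⊇ (suc n) t (suc j) z∈ = ∈-++⁺ʳ (endpoints (t zero)) (tupleEndpoints-⊇ n (t ∘ suc) j z∈)

endpoints-length : ∀ e → length (endpoints e) ℕ.≤ 2
endpoints-length nothing = z≤n
endpoints-length (just _) = ℕ.≤-refl

tupleEndpoints-length : ∀ n t → length (tupleEndpoints n t) ℕ.≤ n ℕ.+ n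
tupleEndpoints-length zero t = z≤n
tupleEndpoints-length (suc n) t = begin
  length (endpoints (t zero) ++ tupleEndpoints n (t ∘ suc))
    ≡⟨ length-++ (endpoints (t zero)) ⟩
  length (endpoints (t zero)) ℕ.+ length (tupleEndpoints n (t ∘ suc))
    ≤⟨ ℕ.+-mono-≤ (endpoints-length (t zero)) (tupleEndpoints-length n (t ∘ suc)) ⟩
  2 ℕ.+ (n ℕ.+ n)
    ≡⟨ cong suc (sym (ℕ.+-suc n n)) ⟩
  suc n ℕ.+ suc n ∎
  where open ℕ.≤-Reasoning

-- S has finitely many orbits on n-tuples: moving all endpoints of a tuple onto
-- naturals below 2n, every tuple becomes the image of a tuple of codes, and
-- tuples of codes are indexed by Fin (|Code (2n)| ^ n).
orbits : ∀ n → FinitelyManyOrbits S n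
orbits n = suc (M ℕ.* M) ℕ.^ n , (λ r j → decode M (finToFun r j)) , λ t → orbit-of t
  where
  M = n ℕ.+ n
  orbit-of : (t : Fin n → Elem) → Σ (Fin (suc (M ℕ.* M) ℕ.^ n)) λ r → Σ (Automorphism S) λ α →
    ∀ j → aut S α (decode M (finToFun r j)) ≡ t j
  orbit-of t = funToFin code , induced h , λ j → trans
      (cong (mapElem (to h) ∘ decode M) (finToFun-funToFin code j))
      (decode-encode h M (t j) (reps j))
    where
    L = tupleEndpoints n t
    moved = homogeneous L
    h = proj₁ moved
    reps : ∀ j → All (Represented h M) (endpoints (t j))
    reps j = All.tabulate λ z∈ →
      let r , r<len , hr≡z = proj₂ moved (tupleEndpoints-⊇ n t j z∈)
      in r , ℕ.<-≤-trans r<len (tupleEndpoints-length n t) , hr≡z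
    code : Fin n → Code M
    code j = encode h M (t j) (reps j)

-- Countability: 2 ^ m * (2 n + 1) injects ℕ × ℕ into ℕ, and ℤ, ℚ and the
-- elements of S are encoded through it.
pair : ℕ → ℕ → ℕ
pair zero n = suc (2 ℕ.* n)
pair (suc m) n = 2 ℕ.* pair m n

pair-injective : ∀ m n m′ n′ → pair m n ≡ pair m′ n′ → m ≡ m′ × n ≡ n′
pair-injective zero n zero n′ eq = refl , ℕ.*-cancelˡ-≡ n n′ 2 (ℕ.suc-injective eq)
pair-injective zero n (suc m′) n′ eq = ⊥-elim (ℕ.even≢odd (pair m′ n′) n (sym eq))
pair-injective (suc m) n zero n′ eq = ⊥-elim (ℕ.even≢odd (pair m n) n′ eq)
pair-injective (suc m) n (suc m′) n′ eq with pair-injective m n m′ n′ (ℕ.*-cancelˡ-≡ _ _ 2 eq)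
... | refl , refl = refl , refl

encodeℤ : ℤ.ℤ → ℕ
encodeℤ (ℤ.+ n) = 2 ℕ.* n
encodeℤ ℤ.-[1+ n ] = suc (2 ℕ.* n)

encodeℤ-injective : ∀ x y → encodeℤ x ≡ encodeℤ y → x ≡ y
encodeℤ-injective (ℤ.+ m) (ℤ.+ n) eq = cong ℤ.+_ (ℕ.*-cancelˡ-≡ m n 2 eq)
encodeℤ-injective (ℤ.+ m) ℤ.-[1+ n ] eq = ⊥-elim (ℕ.even≢odd m n eq)
encodeℤ-injective ℤ.-[1+ m ] (ℤ.+ n) eq = ⊥-elim (ℕ.even≢odd n m (sym eq))
encodeℤ-injective ℤ.-[1+ m ] ℤ.-[1+ n ] eq = cong ℤ.-[1+_] (ℕ.*-cancelˡ-≡ m n 2 (ℕ.suc-injective eq))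

-- a rational in lowest terms is determined by numerator and denominator
encodeℚ : ℚ → ℕ
encodeℚ q = pair (encodeℤ (↥ q)) (ℚ.denominator-1 q)

encodeℚ-injective : ∀ p q → encodeℚ p ≡ encodeℚ q → p ≡ q
encodeℚ-injective (mkℚ m d _) (mkℚ n e _) eq with pair-injective _ _ _ _ eq
... | m≡n , d≡e = mkℚ-cong (encodeℤ-injective m n m≡n) d≡e

encodeElem : Elem → ℕ
encodeElem nothing = 0
encodeElem (just (a , b)) = suc (pair (encodeℚ a) (encodeℚ b))

encodeElem-injective : ∀ x y → encodeElem x ≡ encodeElem y → x ≡ y
encodeElem-injective nothing nothing eq = refl
encodeElem-injective (just (a , b)) (just (c , d)) eq with pair-injective _ _ _ _ (ℕ.suc-injective eq)
... | a≡c , b≡d = cong₂ (λ x y → just (x , y)) (encodeℚ-injective a c a≡c) (encodeℚ-injective b d b≡d)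

-- Non-nilpotency: the blocks (2k , 2k + 1) chain together, so products of
-- consecutive blocks never vanish.
block : ℕ → Elem
block k = just (fromℕ (2 ℕ.* k) , fromℕ (suc (2 ℕ.* k)))

prod-cong : ∀ {m} {x y : Fin (suc m) → Elem} → (∀ i → x i ≡ y i) → prod S x ≡ prod S y
prod-cong {zero} x≡y = x≡y zero
prod-cong {suc m} x≡y = cong₂ _∙_ (x≡y zero) (prod-cong (x≡y ∘ suc))

blocks-product : ∀ m k → Σ ℕ λ r → 2 ℕ.* k ℕ.< r ×
  prod S {m} (λ i → block (k ℕ.+ toℕ i)) ≡ just (fromℕ (2 ℕ.* k) , fromℕ r)
blocks-product zero k = suc (2 ℕ.* k) , ℕ.n<1+n _ , cong block (ℕ.+-identityʳ k)
blocks-product (suc m) k with blocks-product m (suc k)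
... | r , 2k+2<r , rest≡ = r , ℕ.<-trans 2k<2k+2 2k+2<r , (begin
  block (k ℕ.+ 0) ∙ prod S {m} (λ i → block (k ℕ.+ suc (toℕ i)))
    ≡⟨ cong₂ _∙_ (cong block (ℕ.+-identityʳ k)) (prod-cong {m} (λ i → cong block (ℕ.+-suc k (toℕ i)))) ⟩
  block k ∙ prod S {m} (λ i → block (suc k ℕ.+ toℕ i))
    ≡⟨ cong (block k ∙_) rest≡ ⟩
  join (chain? (fromℕ (2 ℕ.* k)) (fromℕ (suc (2 ℕ.* k))) (fromℕ (2 ℕ.* suc k)) (fromℕ r)) (fromℕ (2 ℕ.* k)) (fromℕ r)
    ≡⟨ join-yes _ _ (fromℕ-mono-< (ℕ.n<1+n _) , fromℕ-mono-< 2k+1<2k+2 , fromℕ-mono-< 2k+2<r) (chain? _ _ _ _) ⟩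
  just (fromℕ (2 ℕ.* k) , fromℕ r) ∎)
  where
  open ≡-Reasoning
  2k+1<2k+2 : suc (2 ℕ.* k) ℕ.< 2 ℕ.* suc k
  2k+1<2k+2 = subst (suc (2 ℕ.* k) ℕ.<_) (sym (ℕ.*-suc 2 k)) (ℕ.n<1+n _)
  2k<2k+2 : 2 ℕ.* k ℕ.< 2 ℕ.* suc k
  2k<2k+2 = ℕ.<-trans (ℕ.n<1+n _) 2k+1<2k+2

theorem2p16 : Σ SemigroupWithZero λ S →
    ℵ₀-categorical S × Nil S
      × ((m : ℕ) → Σ (Fin (suc m) → SemigroupWithZero.Carrier S) λ x →
           prod S x ≢ SemigroupWithZero.0# S)
theorem2p16 = S , ℵ₀-cat , nil , not-nilpotent
  where
  ℵ₀-cat : ℵ₀-categorical S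
  ℵ₀-cat = (encodeElem , λ {x} {y} → encodeElem-injective x y) , λ n _ → orbits n
  nil : Nil S
  nil = 2 , s≤s z≤n , ∙-square
  not-nilpotent : (m : ℕ) → Σ (Fin (suc m) → Elem) λ x → prod S x ≢ nothing
  not-nilpotent m with blocks-product m 0
  ... | _ , _ , product≡pair = block ∘ toℕ , λ product≡0 → just≢nothing (trans (sym product≡pair) product≡0)
    where
    just≢nothing : ∀ {p : ℚ × ℚ} → just p ≢ nothing
    just≢nothing ()
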